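{- Let $(A,\mathbf{C}^t)$ be a tangled closure algebra with induced closure operator $\mathbf{C}$. Then for every finite non-empty subset $\varGamma\subseteq A$, $$\mathbf{C}^t\varGamma=\bigvee\Big\{a\in A:\ a\leq \textstyle\bigwedge_{\gamma\in\varGamma}\mathbf{C}(\gamma\land a)\Big\},$$ i.e. this join exists in $A$ and equals $\mathbf{C}^t\varGamma$.
   Context: Let $A$ be a Boolean algebra with operations $\land,\lor,-,0,1$; write $a\Rightarrow b=-a\lor b$. A closure operator on $A$ is a map $\mathbf{C}:A\to A$ with $\mathbf{C}(a\lor b)=\mathbf{C}a\lor\mathbf{C}b$, $\mathbf{C}0=0$, $a\leq\mathbf{C}a=\mathbf{C}\mathbf{C}a$; its dual interior operator is $\mathbf{I}a=-\mathbf{C}-a$. Let $\mathcal{P}_{fin}A$ be the set of finite non-empty subsets of $A$. Given $\mathbf{C}^t:\mathcal{P}_{fin}A\to A$, the induced unary map is $\mathbf{C}a=\mathbf{C}^t\{a\}$ and $\mathbf{I}a=-\mathbf{C}^t\{ -a\}$. $(A,\mathbf{C}^t)$ is a tangled closure algebra if the induced $\mathbf{C}$ is a closure operator and for all $\varGamma\in\mathcal{P}_{fin}A$ and $a\in A$: (Fix) $\mathbf{C}^t\varGamma\leq\bigwedge_{\gamma\in\varGamma}\mathbf{C}(\gamma\land\mathbf{C}^t\varGamma)$; (Ind) $\mathbf{I}\big(a\Rightarrow\bigwedge_{\gamma\in\varGamma}\mathbf{C}(\gamma\land a)\big)\land a\leq\mathbf{C}^t\varGamma$. -}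

module Defs where

open import Level using (Level; _⊔_; suc)
open import Algebra.Lattice.Bundles using (BooleanAlgebra)
open import Data.List using (List; []; _∷_; foldr)
open import Data.List.NonEmpty using (List⁺; [_]; toList)
open import Data.List.Membership.Setoid using ()
open import Data.List.Relation.Binary.Pointwise using (Pointwise)
open import Data.List.Relation.Unary.Any using (Any)
open import Data.Product using (_×_)

module BA {c ℓ : Level} (A : BooleanAlgebra c ℓ) where
  open BooleanAlgebra A public

  infix 4 _≤_
  _≤_ : Carrier → Carrier → Set ℓ
  a ≤ b = (a ∧ b) ≈ a

  _⇒_ : Carrier → Carrier → Carrier
  a ⇒ b = (¬ a) ∨ b

  ⋀ : List Carrier → Carrier
  ⋀ = foldr _∧_ ⊤

  -- finite non-empty "subsets" of A are represented by non-empty lists;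
  -- equality of such lists is pointwise ≈
  _≋⁺_ : List⁺ Carrier → List⁺ Carrier → Set (c ⊔ ℓ)
  Γ ≋⁺ Δ = Pointwise _≈_ (toList Γ) (toList Δ)

  ⋀[_]_ : List⁺ Carrier → (Carrier → Carrier) → Carrier
  ⋀[ Γ ] f = ⋀ (Data.List.map f (toList Γ))

  record IsClosureOperator (C : Carrier → Carrier) : Set (c ⊔ ℓ) where
    field
      cong     : ∀ {a b} → a ≈ b → C a ≈ C b
      additive : ∀ a b → C (a ∨ b) ≈ (C a ∨ C b)
      normal   : C ⊥ ≈ ⊥
      inflat   : ∀ a → a ≤ C a
      idem     : ∀ a → C a ≈ C (C a)

  record IsTangledClosureAlgebra (Ct : List⁺ Carrier → Carrier) : Set (c ⊔ ℓ) where
    C : Carrier → Carrier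
    C a = Ct [ a ]
    I : Carrier → Carrier
    I a = ¬ Ct [ ¬ a ]
    field
      Ct-cong   : ∀ {Γ Δ} → Γ ≋⁺ Δ → Ct Γ ≈ Ct Δ
      isClosure : IsClosureOperator C
      Fix : ∀ (Γ : List⁺ Carrier) → Ct Γ ≤ (⋀[ Γ ] λ γ → C (γ ∧ Ct Γ))
      Ind : ∀ (Γ : List⁺ Carrier) (a : Carrier) →
              (I (a ⇒ (⋀[ Γ ] λ γ → C (γ ∧ a))) ∧ a) ≤ Ct Γ

  IsJoin : ∀ {p} → (Carrier → Set p) → Carrier → Set (c ⊔ ℓ ⊔ p)
  IsJoin S s = (∀ a → S a → a ≤ s) × (∀ u → (∀ a → S a → a ≤ u) → s ≤ u)

  open Data.List using (map)

-- Fix says Ct Γ is itself a post-fixpoint of a ↦ ⋀_{γ ∈ Γ} C (γ ∧ a), so it lies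
-- below every upper bound of the post-fixpoints.  Conversely, for a post-fixpoint a
-- the implication a ⇒ ⋀_{γ ∈ Γ} C (γ ∧ a) is ⊤, whose interior is ⊤, so Ind
-- collapses to a ≤ Ct Γ.
module Submission where

open import Defs
open import Level using (Level)
open import Algebra.Lattice.Bundles using (BooleanAlgebra)
open import Data.List.NonEmpty using (List⁺)
open import Data.List.Relation.Binary.Pointwise using ([]; _∷_)
open import Data.Product using (_,_; proj₁)
import Algebra.Lattice.Properties.BooleanAlgebra as BooleanAlgebraProperties
import Relation.Binary.Reasoning.Setoid as SetoidReasoning

module _ {c ℓ : Level} (A : BooleanAlgebra c ℓ) where
  open BA A
  open BooleanAlgebraProperties A
  open SetoidReasoning setoid

  ≤⇒⇒≈⊤ : ∀ {a b} → a ≤ b → (a ⇒ b) ≈ ⊤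
  ≤⇒⇒≈⊤ {a} {b} a≤b = begin
    ¬ a ∨ b                ≈⟨ ∧-identityˡ _ ⟨
    ⊤ ∧ (¬ a ∨ b)          ≈⟨ ∧-congʳ (proj₁ ∨-complement a) ⟨
    (¬ a ∨ a) ∧ (¬ a ∨ b)  ≈⟨ ∨-distribˡ-∧ (¬ a) a b ⟨
    ¬ a ∨ (a ∧ b)          ≈⟨ ∨-congˡ a≤b ⟩
    ¬ a ∨ a                ≈⟨ proj₁ ∨-complement a ⟩
    ⊤                      ∎

  ≈⊤-∧-≤⇒≤ : ∀ {t a b} → t ≈ ⊤ → (t ∧ a) ≤ b → a ≤ b
  ≈⊤-∧-≤⇒≤ {t} {a} {b} t≈⊤ ta≤b = begin
    a ∧ b        ≈⟨ ∧-congʳ t∧a≈a ⟨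
    (t ∧ a) ∧ b  ≈⟨ ta≤b ⟩
    t ∧ a        ≈⟨ t∧a≈a ⟩
    a            ∎
    where
    t∧a≈a : t ∧ a ≈ a
    t∧a≈a = trans (∧-congʳ t≈⊤) (∧-identityˡ a)

  module _ {Ct : List⁺ Carrier → Carrier} (T : IsTangledClosureAlgebra Ct) where
    open IsTangledClosureAlgebra T
    open IsClosureOperator isClosure using (normal)

    I-≈⊤ : ∀ {a} → a ≈ ⊤ → I a ≈ ⊤
    I-≈⊤ {a} a≈⊤ = begin
      ¬ C (¬ a)     ≈⟨ ¬-cong (Ct-cong (trans (¬-cong a≈⊤) ¬⊤≈⊥ ∷ [])) ⟩
      ¬ C ⊥         ≈⟨ ¬-cong normal ⟩
      ¬ ⊥           ≈⟨ ¬⊥≈⊤ ⟩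
      ⊤             ∎

    postfixed⇒≤Ct : ∀ Γ a → a ≤ (⋀[ Γ ] λ γ → C (γ ∧ a)) → a ≤ Ct Γ
    postfixed⇒≤Ct Γ a postfixed = ≈⊤-∧-≤⇒≤ (I-≈⊤ (≤⇒⇒≈⊤ postfixed)) (Ind Γ a)

lemma2p1 : ∀ {c ℓ : Level} (A : BooleanAlgebra c ℓ) →
    let open BA A in
    (Ct : List⁺ Carrier → Carrier) →
    (T : IsTangledClosureAlgebra Ct) →
    let open IsTangledClosureAlgebra T using (C) in
    (Γ : List⁺ Carrier) →
    IsJoin (λ a → a ≤ (⋀[ Γ ] λ γ → C (γ ∧ a))) (Ct Γ)
lemma2p1 A Ct T Γ = postfixed⇒≤Ct A T Γ , λ u bounds → bounds (Ct Γ) (Fix Γ)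
  where open BA.IsTangledClosureAlgebra T using (Fix)
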